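{- Let $k\geq 4$ be even and let $G$ be a metric graph on $n$ vertices with $k$ dividing $n$. Let $\mathcal{P}^*_k$ be a maximum weight $k$-path packing and $\mathcal{C}^*_k$ a maximum weight $k$-cycle packing of $G$. Writing each path of $\mathcal{P}^*_k$ as $P_i=v_{i1}v_{i2}\cdots v_{ik}$, let $\mathcal{M}_{n/2}=\bigcup_i\{v_{i(2j-1)}v_{i(2j)}: 1\leq j\leq k/2\}$. Then $$w(\mathcal{C}^*_k)\geq\frac{k-2}{k-1}w(\mathcal{P}^*_k)+\frac{2}{k-1}w(\mathcal{M}_{n/2}).$$
   Context: A metric graph is an undirected complete graph with a non-negative edge weight function $w$ satisfying the triangle inequality; the weight of a set of edges (or of paths/cycles) is the total weight of the edges. A $k$-path (resp. $k$-cycle) is a simple path (resp. cycle) on exactly $k$ distinct vertices; a $k$-path (resp. $k$-cycle) packing is a set of $n/k$ vertex-disjoint $k$-paths (resp. $k$-cycles) covering all vertices.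
   Formalization: The edge weights of the metric graph are rational rather than real. -}

module Defs where

open import Data.Nat as ℕ using (ℕ; zero; suc; _≤_; _∸_; s≤s; z≤n)
open import Data.Fin using (Fin)
open import Data.List using (List; []; _∷_; concat; map; allFin)
open import Data.Vec as Vec using (Vec)
open import Data.List.Relation.Binary.Permutation.Propositional using (_↭_)
open import Data.Rational using (ℚ; 0ℚ; _+_) renaming (_≤_ to _≤ℚ_)
open import Data.Product using (_×_)
open import Relation.Binary.PropositionalEquality using (_≡_; _≢_)

-- A weight function on the complete graph on vertex set Fin n.
Weight : ℕ → Set
Weight n = Fin n → Fin n → ℚ

-- Metric: symmetric, non-negative, triangle inequality (on distinct vertices;
-- the diagonal values w u u are never used).
IsMetric : ∀ {n} → Weight n → Set
IsMetric {n} w =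
  (∀ (u v : Fin n) → u ≢ v → w u v ≡ w v u) ×
  (∀ (u v : Fin n) → u ≢ v → 0ℚ ≤ℚ w u v) ×
  (∀ (u v x : Fin n) → u ≢ v → u ≢ x → v ≢ x → w u v ≤ℚ (w u x + w x v))

module _ {n : ℕ} (w : Weight n) where

  pathWeight : List (Fin n) → ℚ
  pathWeight [] = 0ℚ
  pathWeight (x ∷ []) = 0ℚ
  pathWeight (x ∷ y ∷ rest) = w x y + pathWeight (y ∷ rest)

  lastOf : Fin n → List (Fin n) → Fin n
  lastOf x [] = x
  lastOf x (y ∷ ys) = lastOf y ys

  cycleWeight : List (Fin n) → ℚ
  cycleWeight [] = 0ℚ
  cycleWeight (x ∷ xs) = pathWeight (x ∷ xs) + w (lastOf x xs) x

  pairWeight : List (Fin n) → ℚ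
  pairWeight [] = 0ℚ
  pairWeight (x ∷ []) = 0ℚ
  pairWeight (x ∷ y ∷ rest) = w x y + pairWeight rest

  sumℚ : List ℚ → ℚ
  sumℚ [] = 0ℚ
  sumℚ (q ∷ qs) = q + sumℚ qs

-- A k-packing: a list of vertex sequences of length k whose concatenation is
-- a permutation of all vertices (so they are simple, vertex-disjoint, cover
-- all n vertices, and there are n/k of them). The same data describes a
-- k-path packing (read as paths) or a k-cycle packing (read as cycles).
IsPacking : (n k : ℕ) → List (Vec (Fin n) k) → Set
IsPacking n k P = concat (map Vec.toList P) ↭ allFin n

module _ {n k : ℕ} (w : Weight n) where

  pathPackingWeight : List (Vec (Fin n) k) → ℚ
  pathPackingWeight P = sumℚ w (map (λ p → pathWeight w (Vec.toList p)) P)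

  cyclePackingWeight : List (Vec (Fin n) k) → ℚ
  cyclePackingWeight C = sumℚ w (map (λ c → cycleWeight w (Vec.toList c)) C)

  matchingWeight : List (Vec (Fin n) k) → ℚ
  matchingWeight P = sumℚ w (map (λ p → pairWeight w (Vec.toList p)) P)

  IsMaxPathPacking : List (Vec (Fin n) k) → Set
  IsMaxPathPacking P = IsPacking n k P ×
    (∀ Q → IsPacking n k Q → pathPackingWeight Q ≤ℚ pathPackingWeight P)

  IsMaxCyclePacking : List (Vec (Fin n) k) → Set
  IsMaxCyclePacking C = IsPacking n k C ×
    (∀ Q → IsPacking n k Q → cyclePackingWeight Q ≤ℚ cyclePackingWeight C)

nz-pred : ∀ {k} → 4 ≤ k → ℕ.NonZero (k ∸ 1)
nz-pred (s≤s (s≤s _)) = _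

module Submission where

-- Write a path of the packing as v₁ ⋯ v_k.  For 1 ≤ i < k, keeping v₁ ⋯ vᵢ and
-- reversing vᵢ₊₁ ⋯ v_k gives a k-cycle that trades the path edge vᵢvᵢ₊₁ for the chords vᵢv_k
-- and vᵢ₊₁v₁.  Summed over i, the k − 1 cycles weigh (k − 2) w(P) plus the chords; those from
-- v_k and those from v₁ each dominate the edges v₁v₂, v₃v₄, … of P by the triangle inequality.
-- For fixed i, the i-th cycles of all paths of a path packing form a k-cycle packing, so each
-- weighs at most w(C*), and (k − 1) w(C*) ≥ (k − 2) w(P*) + 2 w(M).

open import Defs

open import Data.Nat as ℕ using (ℕ; zero; suc; _∸_; s≤s)
open import Data.Nat.Divisibility using (_∣_)
open import Data.Fin as Fin using (Fin)
import Data.Integer as ℤ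
import Data.Integer.Properties as ℤ
open import Data.Integer.Tactic.RingSolver using (solve-∀)
open import Data.List as List using (List; []; _∷_; _++_; _ʳ++_; map; length; concat; reverse)
import Data.List.Properties as List
open import Data.List.NonEmpty as List⁺ using (List⁺; _∷_; _∷⁺_; [_])
open import Data.List.Relation.Unary.All as All using (All; []; _∷_)
import Data.List.Relation.Unary.All.Properties as All
open import Data.List.Relation.Unary.Unique.Propositional using (Unique; []; _∷_)
open import Data.List.Relation.Unary.Unique.Propositional.Properties using (allFin⁺)
open import Data.List.Relation.Binary.Permutation.Propositional
  using (_↭_; prep; ↭-refl; ↭-sym; ↭-reflexive; ↭-trans; ↭⇒↭ₛ)
open import Data.List.Relation.Binary.Permutation.Propositional.Properties using (↭-reverse; ++⁺)
open import Data.Vec as Vec using (Vec; []; _∷_)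
import Data.Vec.Properties as Vec
open import Data.Rational using (ℚ; 0ℚ; 1ℚ; _+_; _*_; -_; _/_; _≤_; toℚᵘ)
import Data.Rational.Properties as ℚ
open import Data.Rational.Unnormalised as ℚᵘ using (mkℚᵘ; *≡*) renaming (_/_ to _/ᵘ_)
import Data.Rational.Unnormalised.Properties as ℚᵘ
open import Algebra.Properties.CommutativeMonoid.Mult ℚ.+-0-commutativeMonoid using (_×_; ×-distrib-+)
open import Algebra.Solver.CommutativeMonoid ℚ.+-0-commutativeMonoid using (solve; _⊜_; _⊕_)
open import Data.Product using (∃-syntax; _,_; proj₁; proj₂)
open import Function using (_∘_; id)
import Relation.Binary.PropositionalEquality as ≡
open import Relation.Binary.PropositionalEquality
  using (_≡_; _≢_; refl; sym; trans; cong; cong₂; subst; module ≡-Reasoning)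

-- Arithmetic in ℚ

+-cancelˡ-≤ : ∀ r {p q} → r + p ≤ r + q → p ≤ q
+-cancelˡ-≤ r {p} {q} r+p≤r+q = begin
  p              ≡⟨ -r+[r+p]≡p p ⟨
  - r + (r + p)  ≤⟨ ℚ.+-monoʳ-≤ (- r) r+p≤r+q ⟩
  - r + (r + q)  ≡⟨ -r+[r+p]≡p q ⟩
  q              ∎
  where
  open ℚ.≤-Reasoning
  -r+[r+p]≡p : ∀ p → - r + (r + p) ≡ p
  -r+[r+p]≡p p = trans (sym (ℚ.+-assoc (- r) r p)) (trans (cong (_+ p) (ℚ.+-inverseˡ r)) (ℚ.+-identityˡ p))

×-zeroʳ : ∀ m → m × 0ℚ ≡ 0ℚ
×-zeroʳ zero    = refl
×-zeroʳ (suc m) = cong (0ℚ +_) (×-zeroʳ m)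

toℚᵘ-/ : ∀ i d .{{_ : ℕ.NonZero d}} → toℚᵘ (i / d) ℚᵘ.≃ i /ᵘ d
toℚᵘ-/ i (suc d) = ℚ.toℚᵘ-fromℚᵘ (mkℚᵘ i d)

1+m/1≡[1+m]/1 : ∀ m → 1ℚ + ℤ.+ m / 1 ≡ ℤ.+ suc m / 1
1+m/1≡[1+m]/1 m = ℚ.toℚᵘ-injective (begin
  toℚᵘ (1ℚ + ℤ.+ m / 1)            ≈⟨ ℚ.toℚᵘ-homo-+ 1ℚ (ℤ.+ m / 1) ⟩
  toℚᵘ 1ℚ ℚᵘ.+ toℚᵘ (ℤ.+ m / 1)   ≈⟨ ℚᵘ.+-congʳ (toℚᵘ 1ℚ) (toℚᵘ-/ (ℤ.+ m) 1) ⟩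
  toℚᵘ 1ℚ ℚᵘ.+ ℤ.+ m /ᵘ 1         ≈⟨ *≡* (cross-multiplied (ℤ.+ m)) ⟩
  ℤ.+ suc m /ᵘ 1                   ≈⟨ toℚᵘ-/ (ℤ.+ suc m) 1 ⟨
  toℚᵘ (ℤ.+ suc m / 1)             ∎)
  where
  open ℚᵘ.≃-Reasoning
  cross-multiplied : ∀ (x : ℤ.ℤ) → (ℤ.1ℤ ℤ.* ℤ.1ℤ ℤ.+ x ℤ.* ℤ.1ℤ) ℤ.* ℤ.1ℤ ≡ (ℤ.1ℤ ℤ.+ x) ℤ.* ℤ.1ℤ
  cross-multiplied = solve-∀

d/1*m/d≡m/1 : ∀ m d .{{_ : ℕ.NonZero d}} → (ℤ.+ d / 1) * (ℤ.+ m / d) ≡ ℤ.+ m / 1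
d/1*m/d≡m/1 m d@(suc _) = ℚ.toℚᵘ-injective (begin
  toℚᵘ ((ℤ.+ d / 1) * (ℤ.+ m / d))          ≈⟨ ℚ.toℚᵘ-homo-* (ℤ.+ d / 1) (ℤ.+ m / d) ⟩
  toℚᵘ (ℤ.+ d / 1) ℚᵘ.* toℚᵘ (ℤ.+ m / d)   ≈⟨ ℚᵘ.*-cong (toℚᵘ-/ (ℤ.+ d) 1) (toℚᵘ-/ (ℤ.+ m) d) ⟩
  (ℤ.+ d ℤ.* ℤ.+ m) /ᵘ (1 ℕ.* d)            ≡⟨ cong (_/ᵘ (1 ℕ.* d)) (ℤ.*-comm (ℤ.+ d) (ℤ.+ m)) ⟩
  (ℤ.+ m ℤ.* ℤ.+ d) /ᵘ (1 ℕ.* d)            ≈⟨ ℚᵘ.*-cancelʳ-/ d {ℤ.+ m} {1} ⟩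
  ℤ.+ m /ᵘ 1                                ≈⟨ toℚᵘ-/ (ℤ.+ m) 1 ⟨
  toℚᵘ (ℤ.+ m / 1)                          ∎)
  where open ℚᵘ.≃-Reasoning

m×q≡m/1*q : ∀ m q → m × q ≡ (ℤ.+ m / 1) * q
m×q≡m/1*q zero    q = sym (ℚ.*-zeroˡ q)
m×q≡m/1*q (suc m) q = begin
  q + m × q                   ≡⟨ cong₂ _+_ (sym (ℚ.*-identityˡ q)) (m×q≡m/1*q m q) ⟩
  1ℚ * q + (ℤ.+ m / 1) * q    ≡⟨ ℚ.*-distribʳ-+ q 1ℚ (ℤ.+ m / 1) ⟨
  (1ℚ + ℤ.+ m / 1) * q        ≡⟨ cong (_* q) (1+m/1≡[1+m]/1 m) ⟩
  (ℤ.+ suc m / 1) * q         ∎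
  where open ≡-Reasoning

scale-≤ : ∀ e {W M C} → e × W + 2 × M ≤ suc e × C → (ℤ.+ e / suc e) * W + (ℤ.+ 2 / suc e) * M ≤ C
scale-≤ e {W} {M} {C} bound = ℚ.*-cancelˡ-≤-pos r {{ℚ.normalize-pos (suc e) 1}} (begin
  r * (a * W + b * M)          ≡⟨ ℚ.*-distribˡ-+ r (a * W) (b * M) ⟩
  r * (a * W) + r * (b * M)    ≡⟨ cong₂ _+_ (ℚ.*-assoc r a W) (ℚ.*-assoc r b M) ⟨
  (r * a) * W + (r * b) * M    ≡⟨ cong₂ (λ a′ b′ → a′ * W + b′ * M) (d/1*m/d≡m/1 e (suc e)) (d/1*m/d≡m/1 2 (suc e)) ⟩
  (ℤ.+ e / 1) * W + (ℤ.+ 2 / 1) * M ≡⟨ cong₂ _+_ (m×q≡m/1*q e W) (m×q≡m/1*q 2 M) ⟨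
  e × W + 2 × M                ≤⟨ bound ⟩
  suc e × C                    ≡⟨ m×q≡m/1*q (suc e) C ⟩
  r * C                        ∎)
  where
  open ℚ.≤-Reasoning
  r = ℤ.+ suc e / 1
  a = ℤ.+ e / suc e
  b = ℤ.+ 2 / suc e

-- Cutting a path into a prefix and a suffix

record Split (A : Set) : Set where
  constructor _∥_
  field
    prefix suffix : List⁺ A
open Split

extend : ∀ {A : Set} → A → Split A → Split A
extend x (p ∥ s) = (x ∷⁺ p) ∥ s

splits : ∀ {A : Set} → List A → List (Split A)
splits []          = []
splits (x ∷ [])    = []
splits (x ∷ y ∷ r) = ([ x ] ∥ (y ∷ r)) ∷ map (extend x) (splits (y ∷ r))

splits-++ : ∀ {A : Set} (l : List A) →
  All (λ σ → List⁺.toList (prefix σ) ++ List⁺.toList (suffix σ) ≡ l) (splits l)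
splits-++ []          = []
splits-++ (x ∷ [])    = []
splits-++ (x ∷ y ∷ r) = refl ∷ All.map⁺ (All.map (cong (x ∷_)) (splits-++ (y ∷ r)))

length-splits : ∀ {A : Set} (x : A) xs → length (splits (x ∷ xs)) ≡ length xs
length-splits x []       = refl
length-splits x (y ∷ ys) = cong suc (trans (List.length-map (extend x) (splits (y ∷ ys))) (length-splits y ys))

reverseSuffix : ∀ {A : Set} → Split A → List A
reverseSuffix (p ∥ s) = List⁺.toList p ++ reverse (List⁺.toList s)

flipCycles : ∀ {A : Set} → List A → List (List A)
flipCycles l = map reverseSuffix (splits l)

flips : ∀ {A : Set} {k} → Vec A k → Vec (Vec A k) (k ∸ 1)
flips []              = []
flips (x ∷ [])        = []
flips (x ∷ v@(_ ∷ _)) = (x ∷ Vec.reverse v) ∷ Vec.map (x ∷_) (flips v)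

toList-flips : ∀ {A : Set} {k} (v : Vec A k) → map Vec.toList (Vec.toList (flips v)) ≡ flipCycles (Vec.toList v)
toList-flips []              = refl
toList-flips (x ∷ [])        = refl
toList-flips (x ∷ v@(_ ∷ _)) = cong₂ _∷_ (cong (x ∷_) (Vec.toList-reverse v)) (begin
  map Vec.toList (Vec.toList (Vec.map (x ∷_) (flips v)))
    ≡⟨ cong (map Vec.toList) (Vec.toList-map (x ∷_) (flips v)) ⟩
  map Vec.toList (map (Vec._∷_ x) (Vec.toList (flips v)))
    ≡⟨ List.map-∘ (Vec.toList (flips v)) ⟨
  map (λ c → x ∷ Vec.toList c) (Vec.toList (flips v))
    ≡⟨ List.map-∘ (Vec.toList (flips v)) ⟩
  map (List._∷_ x) (map Vec.toList (Vec.toList (flips v)))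
    ≡⟨ cong (map (x ∷_)) (toList-flips v) ⟩
  map (List._∷_ x) (map reverseSuffix (splits (Vec.toList v)))
    ≡⟨ List.map-∘ (splits (Vec.toList v)) ⟨
  map (λ σ → x ∷ reverseSuffix σ) (splits (Vec.toList v))
    ≡⟨ List.map-∘ (splits (Vec.toList v)) ⟩
  map reverseSuffix (map (extend x) (splits (Vec.toList v))) ∎)
  where open ≡-Reasoning

flips-↭ : ∀ {A : Set} {k} (v : Vec A k) i → Vec.toList (Vec.lookup (flips v) i) ↭ Vec.toList v
flips-↭ (x ∷ v@(_ ∷ _)) Fin.zero    =
  prep x (↭-trans (↭-reflexive (Vec.toList-reverse v)) (↭-reverse (Vec.toList v)))
flips-↭ (x ∷ v@(_ ∷ _)) (Fin.suc i) =
  ↭-trans (↭-reflexive (cong Vec.toList (Vec.lookup-map i (x ∷_) (flips v)))) (prep x (flips-↭ v i))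

-- Packings

Unique-++⁻ˡ : ∀ {A : Set} (xs : List A) {ys} → Unique (xs ++ ys) → Unique xs
Unique-++⁻ˡ []       _        = []
Unique-++⁻ˡ (x ∷ xs) (x∉ ∷ u) = All.++⁻ˡ xs x∉ ∷ Unique-++⁻ˡ xs u

Unique-++⁻ʳ : ∀ {A : Set} (xs : List A) {ys} → Unique (xs ++ ys) → Unique ys
Unique-++⁻ʳ []       u       = u
Unique-++⁻ʳ (x ∷ xs) (_ ∷ u) = Unique-++⁻ʳ xs u

Unique-concat⁻ : ∀ {A : Set} (xss : List (List A)) → Unique (concat xss) → All Unique xss
Unique-concat⁻ []         _ = []
Unique-concat⁻ (xs ∷ xss) u = Unique-++⁻ˡ xs u ∷ Unique-concat⁻ xss (Unique-++⁻ʳ xs u)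

IsPacking⇒Unique : ∀ {n k} {P : List (Vec (Fin n) k)} → IsPacking n k P → All (Unique ∘ Vec.toList) P
IsPacking⇒Unique {n} {P = P} packing =
  All.map⁻ (Unique-concat⁻ (map Vec.toList P) (Unique-resp-↭ (↭⇒↭ₛ (↭-sym packing)) (allFin⁺ n)))
  where open import Data.List.Relation.Binary.Permutation.Setoid.Properties (≡.setoid (Fin n)) using (Unique-resp-↭)

flipPacking : ∀ {A : Set} {k} → Fin (k ∸ 1) → List (Vec A k) → List (Vec A k)
flipPacking i = map (λ p → Vec.lookup (flips p) i)

flipPacking-↭ : ∀ {A : Set} {k} i (P : List (Vec A k)) →
  concat (map Vec.toList (flipPacking i P)) ↭ concat (map Vec.toList P)
flipPacking-↭ i []      = ↭-refl
flipPacking-↭ i (p ∷ P) = ++⁺ (flips-↭ p i) (flipPacking-↭ i P)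

map-lookup-allFin : ∀ {A : Set} {m} (v : Vec A m) → map (Vec.lookup v) (List.allFin m) ≡ Vec.toList v
map-lookup-allFin v = trans (List.map-tabulate id (Vec.lookup v)) (tabulate-lookup v)
  where
  tabulate-lookup : ∀ {m} (v : Vec _ m) → List.tabulate (Vec.lookup v) ≡ Vec.toList v
  tabulate-lookup []      = refl
  tabulate-lookup (x ∷ v) = cong (x ∷_) (tabulate-lookup v)

-- Weights of paths, cycles and chords

module _ {n : ℕ} (w : Weight n) where

  ∑ : List ℚ → ℚ
  ∑ = sumℚ w

  ∑-+ : ∀ {A : Set} (f g : A → ℚ) xs → ∑ (map (λ x → f x + g x) xs) ≡ ∑ (map f xs) + ∑ (map g xs)
  ∑-+ f g []       = sym (ℚ.+-identityʳ 0ℚ)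
  ∑-+ f g (x ∷ xs) = trans (cong (f x + g x +_) (∑-+ f g xs))
    (solve 4 (λ a b c d → (a ⊕ b) ⊕ (c ⊕ d) ⊜ (a ⊕ c) ⊕ (b ⊕ d)) refl (f x) (g x) _ _)

  ∑-× : ∀ {A : Set} m (f : A → ℚ) xs → ∑ (map (λ x → m × f x) xs) ≡ m × ∑ (map f xs)
  ∑-× m f []       = sym (×-zeroʳ m)
  ∑-× m f (x ∷ xs) = trans (cong (m × f x +_) (∑-× m f xs)) (sym (×-distrib-+ (f x) _ m))

  ∑-const : ∀ {A : Set} c (xs : List A) → ∑ (map (λ _ → c) xs) ≡ length xs × c
  ∑-const c []       = refl
  ∑-const c (x ∷ xs) = cong (c +_) (∑-const c xs)

  ∑-comm : ∀ {A B : Set} (f : A → B → ℚ) xs ys →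
    ∑ (map (λ x → ∑ (map (f x) ys)) xs) ≡ ∑ (map (λ y → ∑ (map (λ x → f x y) xs)) ys)
  ∑-comm f xs []       = trans (∑-const 0ℚ xs) (×-zeroʳ (length xs))
  ∑-comm f xs (y ∷ ys) = trans (∑-+ (λ x → f x y) (λ x → ∑ (map (f x) ys)) xs)
                               (cong (∑ (map (λ x → f x y) xs) +_) (∑-comm f xs ys))

  ∑-cong : ∀ {A : Set} {f g : A → ℚ} {xs} → All (λ x → f x ≡ g x) xs → ∑ (map f xs) ≡ ∑ (map g xs)
  ∑-cong []           = refl
  ∑-cong (fx≡gx ∷ eqs) = cong₂ _+_ fx≡gx (∑-cong eqs)

  ∑-mono : ∀ {A : Set} {f g : A → ℚ} {xs} → All (λ x → f x ≤ g x) xs → ∑ (map f xs) ≤ ∑ (map g xs)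
  ∑-mono []             = ℚ.≤-refl
  ∑-mono (fx≤gx ∷ ineqs) = ℚ.+-mono-≤ fx≤gx (∑-mono ineqs)

  ∑-splits : ∀ {A : Set} (f : Split A → ℚ) x y r →
    ∑ (map f (splits (x ∷ y ∷ r))) ≡ f ([ x ] ∥ (y ∷ r)) + ∑ (map (f ∘ extend x) (splits (y ∷ r)))
  ∑-splits f x y r = cong (λ fs → f ([ x ] ∥ (y ∷ r)) + ∑ fs) (sym (List.map-∘ (splits (y ∷ r))))

  ∑-splits-head : ∀ {A : Set} (f : A → ℚ) x xs →
    ∑ (map (f ∘ List⁺.head ∘ suffix) (splits (x ∷ xs))) ≡ ∑ (map f xs)
  ∑-splits-head f x []       = refl
  ∑-splits-head f x (y ∷ ys) = trans (∑-splits (f ∘ List⁺.head ∘ suffix) x y ys)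
                                     (cong (f y +_) (∑-splits-head f y ys))

  lastOf⁺ : List⁺ (Fin n) → Fin n
  lastOf⁺ p = lastOf w (List⁺.head p) (List⁺.tail p)

  -- For the split v₁ ⋯ vᵢ ∥ vᵢ₊₁ ⋯ v_k, the bridge is vᵢvᵢ₊₁ and the chords are vᵢv_k and vᵢ₊₁v₁.
  bridge : Split (Fin n) → ℚ
  bridge (p ∥ s) = w (lastOf⁺ p) (List⁺.head s)

  endChord : Split (Fin n) → ℚ
  endChord (p ∥ s) = w (lastOf⁺ p) (lastOf⁺ s)

  startChord : Split (Fin n) → ℚ
  startChord (p ∥ s) = w (List⁺.head s) (List⁺.head p)

  chords : Split (Fin n) → ℚ
  chords σ = endChord σ + startChord σ

  ∑-bridge : ∀ l → ∑ (map bridge (splits l)) ≡ pathWeight w l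
  ∑-bridge []          = refl
  ∑-bridge (x ∷ [])    = refl
  ∑-bridge (x ∷ y ∷ r) = trans (∑-splits bridge x y r) (cong (w x y +_) (∑-bridge (y ∷ r)))

  All-lastOf : ∀ {P : Fin n → Set} {x xs} → All P (x ∷ xs) → P (lastOf w x xs)
  All-lastOf {xs = []}    (px ∷ _)  = px
  All-lastOf {xs = _ ∷ _} (_ ∷ pxs) = All-lastOf pxs

  lastOf-++ : ∀ x xs y ys → lastOf w x (xs ++ y ∷ ys) ≡ lastOf w y ys
  lastOf-++ x []        y ys = refl
  lastOf-++ x (x′ ∷ xs) y ys = lastOf-++ x′ xs y ys

  lastOf-++-reverse : ∀ x xs y ys → lastOf w x (xs ++ reverse (y ∷ ys)) ≡ y
  lastOf-++-reverse x xs y ys = begin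
    lastOf w x (xs ++ reverse (y ∷ ys))         ≡⟨ cong (λ r → lastOf w x (xs ++ r)) (List.unfold-reverse y ys) ⟩
    lastOf w x (xs ++ (reverse ys ++ y ∷ []))   ≡⟨ cong (lastOf w x) (List.++-assoc xs (reverse ys) (y ∷ [])) ⟨
    lastOf w x ((xs ++ reverse ys) ++ y ∷ [])   ≡⟨ lastOf-++ x (xs ++ reverse ys) y [] ⟩
    y                                           ∎
    where open ≡-Reasoning

  reverse-∷ : ∀ y ys → ∃[ t ] reverse (y ∷ ys) ≡ lastOf w y ys ∷ t
  reverse-∷ y []        = [] , refl
  reverse-∷ y (y′ ∷ ys) with reverse-∷ y′ ys
  ... | t , eq = t List.∷ʳ y , trans (List.unfold-reverse y (y′ ∷ ys)) (cong (List._∷ʳ y) eq)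

  pathWeight-++ : ∀ x xs y ys →
    pathWeight w (x ∷ xs ++ y ∷ ys) ≡ pathWeight w (x ∷ xs) + (w (lastOf w x xs) y + pathWeight w (y ∷ ys))
  pathWeight-++ x []        y ys = sym (ℚ.+-identityˡ _)
  pathWeight-++ x (x′ ∷ xs) y ys = trans (cong (w x x′ +_) (pathWeight-++ x′ xs y ys))
                                         (sym (ℚ.+-assoc (w x x′) (pathWeight w (x′ ∷ xs)) _))

  ∑-flipPacking : ∀ {k} (P : List (Vec (Fin n) k)) →
    ∑ (map (λ i → cyclePackingWeight w (flipPacking i P)) (List.allFin (k ∸ 1)))
      ≡ ∑ (map (λ p → ∑ (map (cycleWeight w) (flipCycles (Vec.toList p)))) P)
  ∑-flipPacking {k} P = begin
    ∑ (map (λ i → cyclePackingWeight w (flipPacking i P)) I)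
      ≡⟨ cong ∑ (List.map-cong (λ i → cong ∑ (List.map-∘ P)) I) ⟨
    ∑ (map (λ i → ∑ (map (λ p → cycleWeight w (Vec.toList (Vec.lookup (flips p) i))) P)) I)
      ≡⟨ ∑-comm (λ i p → cycleWeight w (Vec.toList (Vec.lookup (flips p) i))) I P ⟩
    ∑ (map (λ p → ∑ (map (λ i → cycleWeight w (Vec.toList (Vec.lookup (flips p) i))) I)) P)
      ≡⟨ cong ∑ (List.map-cong (λ p → cong ∑ (cyclesOf p)) P) ⟩
    ∑ (map (λ p → ∑ (map (cycleWeight w) (flipCycles (Vec.toList p)))) P) ∎
    where
    open ≡-Reasoning
    I = List.allFin (k ∸ 1)
    cyclesOf : ∀ p → map (λ i → cycleWeight w (Vec.toList (Vec.lookup (flips p) i))) I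
                     ≡ map (cycleWeight w) (flipCycles (Vec.toList p))
    cyclesOf p = begin
      map (cycleWeight w ∘ Vec.toList ∘ Vec.lookup (flips p)) I
        ≡⟨ List.map-∘ I ⟩
      map (cycleWeight w ∘ Vec.toList) (map (Vec.lookup (flips p)) I)
        ≡⟨ cong (map (cycleWeight w ∘ Vec.toList)) (map-lookup-allFin (flips p)) ⟩
      map (cycleWeight w ∘ Vec.toList) (Vec.toList (flips p))
        ≡⟨ List.map-∘ (Vec.toList (flips p)) ⟩
      map (cycleWeight w) (map Vec.toList (Vec.toList (flips p)))
        ≡⟨ cong (map (cycleWeight w)) (toList-flips p) ⟩
      map (cycleWeight w) (flipCycles (Vec.toList p)) ∎

  module Metric (metric : IsMetric w) where

    w-sym : ∀ u v → u ≢ v → w u v ≡ w v u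
    w-sym = proj₁ metric

    w-nonneg : ∀ u v → u ≢ v → 0ℚ ≤ w u v
    w-nonneg = proj₁ (proj₂ metric)

    w-triangle : ∀ u v x → u ≢ v → u ≢ x → v ≢ x → w u v ≤ w u x + w x v
    w-triangle = proj₂ (proj₂ metric)

    pathWeight-ʳ++ : ∀ {x xs} → Unique (x ∷ xs) → ∀ q →
      pathWeight w (xs ʳ++ x ∷ q) ≡ pathWeight w (x ∷ xs) + pathWeight w (x ∷ q)
    pathWeight-ʳ++ {x} {[]}      _                 q = sym (ℚ.+-identityˡ _)
    pathWeight-ʳ++ {x} {x′ ∷ xs} ((x≢x′ ∷ _) ∷ u) q = begin
      pathWeight w (xs ʳ++ x′ ∷ x ∷ q)
        ≡⟨ pathWeight-ʳ++ u (x ∷ q) ⟩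
      pathWeight w (x′ ∷ xs) + (w x′ x + pathWeight w (x ∷ q))
        ≡⟨ cong (λ e → pathWeight w (x′ ∷ xs) + (e + pathWeight w (x ∷ q))) (w-sym x′ x (x≢x′ ∘ sym)) ⟩
      pathWeight w (x′ ∷ xs) + (w x x′ + pathWeight w (x ∷ q))
        ≡⟨ solve 3 (λ a b c → a ⊕ (b ⊕ c) ⊜ (b ⊕ a) ⊕ c) refl _ (w x x′) _ ⟩
      (w x x′ + pathWeight w (x′ ∷ xs)) + pathWeight w (x ∷ q) ∎
      where open ≡-Reasoning

    pathWeight-reverse : ∀ {l} → Unique l → pathWeight w (reverse l) ≡ pathWeight w l
    pathWeight-reverse {[]}     _ = refl
    pathWeight-reverse {x ∷ xs} u = trans (pathWeight-ʳ++ u []) (ℚ.+-identityʳ _)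

    pathWeight-++-reverse : ∀ x xs {y ys} → Unique (y ∷ ys) →
      pathWeight w (x ∷ xs ++ reverse (y ∷ ys))
        ≡ pathWeight w (x ∷ xs) + (w (lastOf w x xs) (lastOf w y ys) + pathWeight w (y ∷ ys))
    pathWeight-++-reverse x xs {y} {ys} u with reverse-∷ y ys
    ... | t , eq = begin
      pathWeight w (x ∷ xs ++ reverse (y ∷ ys))            ≡⟨ cong (λ r → pathWeight w (x ∷ xs ++ r)) eq ⟩
      pathWeight w (x ∷ xs ++ z ∷ t)                       ≡⟨ pathWeight-++ x xs z t ⟩
      P + (w a z + pathWeight w (z ∷ t))                   ≡⟨ cong (λ r → P + (w a z + pathWeight w r)) eq ⟨
      P + (w a z + pathWeight w (reverse (y ∷ ys)))        ≡⟨ cong (λ e → P + (w a z + e)) (pathWeight-reverse u) ⟩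
      P + (w a z + pathWeight w (y ∷ ys))                  ∎
      where
      open ≡-Reasoning
      P = pathWeight w (x ∷ xs)
      a = lastOf w x xs
      z = lastOf w y ys

    cycleWeight-reverseSuffix : ∀ σ → Unique (List⁺.toList (suffix σ)) →
      cycleWeight w (reverseSuffix σ) + bridge σ
        ≡ pathWeight w (List⁺.toList (prefix σ) ++ List⁺.toList (suffix σ)) + chords σ
    cycleWeight-reverseSuffix ((x ∷ xs) ∥ (y ∷ ys)) u = begin
      (pathWeight w (x ∷ xs ++ reverse (y ∷ ys)) + w (lastOf w x (xs ++ reverse (y ∷ ys))) x) + w a y
        ≡⟨ cong₂ (λ p e → (p + w e x) + w a y) (pathWeight-++-reverse x xs u) (lastOf-++-reverse x xs y ys) ⟩
      ((P + (w a z + S)) + w y x) + w a y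
        ≡⟨ solve 5 (λ p az s yx ay → ((p ⊕ (az ⊕ s)) ⊕ yx) ⊕ ay ⊜ (p ⊕ (ay ⊕ s)) ⊕ (az ⊕ yx))
                 refl P (w a z) S (w y x) (w a y) ⟩
      (P + (w a y + S)) + (w a z + w y x)
        ≡⟨ cong (_+ (w a z + w y x)) (pathWeight-++ x xs y ys) ⟨
      pathWeight w (x ∷ xs ++ y ∷ ys) + (w a z + w y x) ∎
      where
      open ≡-Reasoning
      P = pathWeight w (x ∷ xs)
      S = pathWeight w (y ∷ ys)
      a = lastOf w x xs
      z = lastOf w y ys

    pairWeight-≤-star : ∀ u {vs} → All (u ≢_) vs → Unique vs →
      pairWeight w vs ≤ ∑ (map (λ v → w v u) vs)
    pairWeight-≤-star u {[]}         _                  _ = ℚ.≤-refl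
    pairWeight-≤-star u {a ∷ []}     (u≢a ∷ _)          _ =
      ℚ.≤-trans (w-nonneg a u (u≢a ∘ sym)) (ℚ.≤-reflexive (sym (ℚ.+-identityʳ (w a u))))
    pairWeight-≤-star u {a ∷ b ∷ vs} (u≢a ∷ u≢b ∷ u∉vs) ((a≢b ∷ _) ∷ (_ ∷ uvs)) = begin
      w a b + pairWeight w vs   ≤⟨ ℚ.+-mono-≤ (w-triangle a b u a≢b (u≢a ∘ sym) (u≢b ∘ sym))
                                              (pairWeight-≤-star u u∉vs uvs) ⟩
      (w a u + w u b) + star    ≡⟨ cong (λ e → (w a u + e) + star) (w-sym u b u≢b) ⟩
      (w a u + w b u) + star    ≡⟨ ℚ.+-assoc (w a u) (w b u) star ⟩
      w a u + (w b u + star)    ∎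
      where
      open ℚ.≤-Reasoning
      star = ∑ (map (λ v → w v u) vs)

    pairWeight-≤-∑-startChord : ∀ {l} → Unique l → pairWeight w l ≤ ∑ (map startChord (splits l))
    pairWeight-≤-∑-startChord {[]}        _ = ℚ.≤-refl
    pairWeight-≤-∑-startChord {x ∷ []}    _ = ℚ.≤-refl
    pairWeight-≤-∑-startChord {x ∷ y ∷ r} ((x≢y ∷ x∉r) ∷ (_ ∷ ur)) = begin
      w x y + pairWeight w r
        ≤⟨ ℚ.+-mono-≤ (ℚ.≤-reflexive (w-sym x y x≢y)) (pairWeight-≤-star x x∉r ur) ⟩
      w y x + ∑ (map (λ v → w v x) r)
        ≡⟨ cong (w y x +_) (∑-splits-head (λ v → w v x) y r) ⟨
      w y x + ∑ (map (startChord ∘ extend x) (splits (y ∷ r)))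
        ≡⟨ ∑-splits startChord x y r ⟨
      ∑ (map startChord (splits (x ∷ y ∷ r))) ∎
      where open ℚ.≤-Reasoning

    pairWeight-≤-∑-endChord : ∀ {l} → Unique l → pairWeight w l ≤ ∑ (map endChord (splits l))
    pairWeight-≤-∑-endChord {[]}            _ = ℚ.≤-refl
    pairWeight-≤-∑-endChord {x ∷ []}        _ = ℚ.≤-refl
    pairWeight-≤-∑-endChord {x ∷ y ∷ []}    _ = ℚ.≤-refl
    pairWeight-≤-∑-endChord {x ∷ y ∷ c ∷ r} ((x≢y ∷ x∉cr) ∷ (y∉cr ∷ ucr)) = begin
      w x y + pairWeight w (c ∷ r)
        ≤⟨ ℚ.+-mono-≤ (w-triangle x y z x≢y (All-lastOf x∉cr) (All-lastOf y∉cr)) (pairWeight-≤-∑-endChord ucr) ⟩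
      (w x z + w z y) + rest
        ≡⟨ cong (λ e → (w x z + e) + rest) (w-sym z y (All-lastOf y∉cr ∘ sym)) ⟩
      (w x z + w y z) + rest
        ≡⟨ ℚ.+-assoc (w x z) (w y z) rest ⟩
      w x z + (w y z + rest)
        ≡⟨ cong (w x z +_) (∑-splits (endChord ∘ extend x) y c r) ⟨
      w x z + ∑ (map (endChord ∘ extend x) (splits (y ∷ c ∷ r)))
        ≡⟨ ∑-splits endChord x y (c ∷ r) ⟨
      ∑ (map endChord (splits (x ∷ y ∷ c ∷ r))) ∎
      where
      open ℚ.≤-Reasoning
      z = lastOf w c r
      rest = ∑ (map endChord (splits (c ∷ r)))

    2×pairWeight-≤-∑-chords : ∀ {l} → Unique l → 2 × pairWeight w l ≤ ∑ (map chords (splits l))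
    2×pairWeight-≤-∑-chords {l} u = begin
      2 × pairWeight w l
        ≡⟨ cong (pairWeight w l +_) (ℚ.+-identityʳ _) ⟩
      pairWeight w l + pairWeight w l
        ≤⟨ ℚ.+-mono-≤ (pairWeight-≤-∑-endChord u) (pairWeight-≤-∑-startChord u) ⟩
      ∑ (map endChord (splits l)) + ∑ (map startChord (splits l))
        ≡⟨ ∑-+ endChord startChord (splits l) ⟨
      ∑ (map chords (splits l)) ∎
      where open ℚ.≤-Reasoning

    ∑-cycleWeight-flipCycles : ∀ x y r → Unique (x ∷ y ∷ r) →
      ∑ (map (cycleWeight w) (flipCycles (x ∷ y ∷ r))) + pathWeight w (x ∷ y ∷ r)
        ≡ suc (length r) × pathWeight w (x ∷ y ∷ r) + ∑ (map chords (splits (x ∷ y ∷ r)))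
    ∑-cycleWeight-flipCycles x y r u = begin
      ∑ (map (cycleWeight w) (flipCycles l)) + P
        ≡⟨ cong₂ _+_ (cong ∑ (List.map-∘ {g = cycleWeight w} {f = reverseSuffix} σs)) (∑-bridge l) ⟨
      ∑ (map (cycleWeight w ∘ reverseSuffix) σs) + ∑ (map bridge σs)
        ≡⟨ ∑-+ (cycleWeight w ∘ reverseSuffix) bridge σs ⟨
      ∑ (map (λ σ → cycleWeight w (reverseSuffix σ) + bridge σ) σs)
        ≡⟨ ∑-cong (All.map perSplit (splits-++ l)) ⟩
      ∑ (map (λ σ → P + chords σ) σs)
        ≡⟨ ∑-+ (λ _ → P) chords σs ⟩
      ∑ (map (λ _ → P) σs) + ∑ (map chords σs)
        ≡⟨ cong (_+ ∑ (map chords σs)) (trans (∑-const P σs) (cong (_× P) (length-splits x (y ∷ r)))) ⟩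
      suc (length r) × P + ∑ (map chords σs) ∎
      where
      open ≡-Reasoning
      l = x ∷ y ∷ r
      σs = splits l
      P = pathWeight w l
      perSplit : ∀ {σ} → List⁺.toList (prefix σ) ++ List⁺.toList (suffix σ) ≡ l →
        cycleWeight w (reverseSuffix σ) + bridge σ ≡ P + chords σ
      perSplit {σ} eq =
        trans (cycleWeight-reverseSuffix σ (Unique-++⁻ʳ (List⁺.toList (prefix σ)) (subst Unique (sym eq) u)))
              (cong (λ l′ → pathWeight w l′ + chords σ) eq)

    flipCycles-bound : ∀ l → Unique l →
      (length l ∸ 2) × pathWeight w l + 2 × pairWeight w l ≤ ∑ (map (cycleWeight w) (flipCycles l))
    flipCycles-bound []          _ = ℚ.≤-refl
    flipCycles-bound (x ∷ [])    _ = ℚ.≤-refl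
    flipCycles-bound (x ∷ y ∷ r) u = +-cancelˡ-≤ P (begin
      P + (length r × P + 2 × pairWeight w l)
        ≤⟨ ℚ.+-monoʳ-≤ P (ℚ.+-monoʳ-≤ (length r × P) (2×pairWeight-≤-∑-chords u)) ⟩
      P + (length r × P + ∑ (map chords (splits l)))
        ≡⟨ ℚ.+-assoc P _ _ ⟨
      suc (length r) × P + ∑ (map chords (splits l))
        ≡⟨ ∑-cycleWeight-flipCycles x y r u ⟨
      ∑ (map (cycleWeight w) (flipCycles l)) + P
        ≡⟨ ℚ.+-comm _ P ⟩
      P + ∑ (map (cycleWeight w) (flipCycles l)) ∎)
      where
      open ℚ.≤-Reasoning
      l = x ∷ y ∷ r
      P = pathWeight w l

    cyclePacking-bound : ∀ {k} (P C : List (Vec (Fin n) k)) → IsPacking n k P → IsMaxCyclePacking w C →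
      (k ∸ 2) × pathPackingWeight w P + 2 × matchingWeight w P ≤ (k ∸ 1) × cyclePackingWeight w C
    cyclePacking-bound {k} P C packing (_ , maximal) = begin
      (k ∸ 2) × ∑ (map (pw ∘ Vec.toList) P) + 2 × ∑ (map (prw ∘ Vec.toList) P)
        ≡⟨ cong₂ _+_ (∑-× (k ∸ 2) (pw ∘ Vec.toList) P) (∑-× 2 (prw ∘ Vec.toList) P) ⟨
      ∑ (map (λ p → (k ∸ 2) × pw (Vec.toList p)) P) + ∑ (map (λ p → 2 × prw (Vec.toList p)) P)
        ≡⟨ ∑-+ (λ p → (k ∸ 2) × pw (Vec.toList p)) (λ p → 2 × prw (Vec.toList p)) P ⟨
      ∑ (map (λ p → (k ∸ 2) × pw (Vec.toList p) + 2 × prw (Vec.toList p)) P)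
        ≤⟨ ∑-mono {xs = P} (All.map (λ {p} → pathBound p) (IsPacking⇒Unique packing)) ⟩
      ∑ (map (λ p → ∑ (map (cycleWeight w) (flipCycles (Vec.toList p)))) P)
        ≡⟨ ∑-flipPacking P ⟨
      ∑ (map (λ i → cyclePackingWeight w (flipPacking i P)) I)
        ≤⟨ ∑-mono {xs = I} (All.universal (λ i → maximal (flipPacking i P) (↭-trans (flipPacking-↭ i P) packing)) I) ⟩
      ∑ (map (λ _ → cyclePackingWeight w C) I)
        ≡⟨ ∑-const (cyclePackingWeight w C) I ⟩
      length I × cyclePackingWeight w C
        ≡⟨ cong (_× cyclePackingWeight w C) (List.length-tabulate {n = k ∸ 1} id) ⟩
      (k ∸ 1) × cyclePackingWeight w C ∎
      where
      open ℚ.≤-Reasoning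
      pw prw : List (Fin n) → ℚ
      pw = pathWeight w
      prw = pairWeight w
      I = List.allFin (k ∸ 1)
      pathBound : ∀ (p : Vec (Fin n) k) → Unique (Vec.toList p) →
        (k ∸ 2) × pw (Vec.toList p) + 2 × prw (Vec.toList p) ≤ ∑ (map (cycleWeight w) (flipCycles (Vec.toList p)))
      pathBound p u = subst (λ m → (m ∸ 2) × pw (Vec.toList p) + 2 × prw (Vec.toList p)
                                     ≤ ∑ (map (cycleWeight w) (flipCycles (Vec.toList p))))
                            (Vec.length-toList p) (flipCycles-bound (Vec.toList p) u)

lemmap1 : (k n : ℕ) (4≤k : 4 ℕ.≤ k) → 2 ∣ k → k ∣ n →
    (w : Weight n) → IsMetric w →
    (P* C* : List (Vec (Fin n) k)) →
    IsMaxPathPacking w P* → IsMaxCyclePacking w C* →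
    ((_/_ (ℤ.+ (k ∸ 2)) (k ∸ 1) {{nz-pred 4≤k}}) * pathPackingWeight w P*
      + (_/_ (ℤ.+ 2) (k ∸ 1) {{nz-pred 4≤k}}) * matchingWeight w P*)
      ≤ cyclePackingWeight w C*
lemmap1 k@(suc (suc (suc (suc _)))) n (s≤s (s≤s (s≤s (s≤s _)))) _ _ w metric P* C* (packing , _) maximal =
  scale-≤ (k ∸ 2) (Metric.cyclePacking-bound w metric P* C* packing maximal)
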